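{- Let $n\ge1$, $A\ge 2$ be integers, and let $(n_{x,y})_{x,y\in[n]}$ be fixed nonnegative integers with $N=\sum_{x,y}n_{x,y}>0$. Define $\hat p_x=\sum_{y}n_{x,y}/N$, $\hat q_y=\sum_{x}n_{x,y}/N$, $\hat\Delta_{x,y}=n_{x,y}/N-\hat p_x\hat q_y$ and $\|\hat\Delta\|^2=\sum_{x,y\in[n]}\hat\Delta_{x,y}^2$. Let $h_1,h_2:[n]\to[A]$ be independent, uniformly random functions. For $a,b\in[A]$ let $C_{a,b}=\sum_{x\in h_1^{ -1}(a),\,y\in h_2^{ -1}(b)}n_{x,y}$ and $$\tilde\Delta_{a,b}=\frac{C_{a,b}}{N}-\frac{\big(\sum_{b'\in[A]}C_{a,b'}\big)\big(\sum_{a'\in[A]}C_{a',b}\big)}{N^2},\qquad \|\tilde\Delta\|^2=\sum_{a,b\in[A]}\tilde\Delta_{a,b}^2.$$ Then $\mathbb{E}\big[\|\tilde\Delta\|^2\big]=(1-1/A)^2\|\hat\Delta\|^2$, i.e. $\|\tilde\Delta\|^2/(1-1/A)^2$ is an unbiased estimator of $\|\hat\Delta\|^2$ (expectation over the random choice of $h_1,h_2$).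
   Context: $n_{x,y}$ is the number of times the pair $(x,y)$ appears in a stream of $N$ pairs from $[n]\times[n]$; $C$ is the $A\times A$ counter matrix obtained by incrementing $C_{h_1(x),h_2(y)}$ for each stream pair $(x,y)$. $[m]=\{1,\dots,m\}$. -}

module Defs where

open import Data.Nat as ℕ using (ℕ; zero; suc; NonZero)
open import Data.Nat.Properties using (m*n≢0; m^n≢0)
open import Data.Fin using (Fin; _≟_)
open import Data.Integer using (+_)
open import Data.Rational using (ℚ; _+_; _*_; _-_; _/_; 0ℚ; 1ℚ)
open import Data.Vec.Functional using (_∷_)
open import Data.Bool using (if_then_else_)
open import Relation.Nullary.Decidable using (⌊_⌋)

sumℕ : (m : ℕ) → (Fin m → ℕ) → ℕ
sumℕ zero    f = 0
sumℕ (suc m) f = f Data.Fin.zero ℕ.+ sumℕ m (λ i → f (Data.Fin.suc i))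

sumℚ : (m : ℕ) → (Fin m → ℚ) → ℚ
sumℚ zero    f = 0ℚ
sumℚ (suc m) f = f Data.Fin.zero + sumℚ m (λ i → f (Data.Fin.suc i))

sumFun : (n A : ℕ) → ((Fin n → Fin A) → ℚ) → ℚ
sumFun zero    A F = F (λ ())
sumFun (suc n) A F = sumℚ A (λ a → sumFun n A (λ h → F (a ∷ h)))

toℚ : ℕ → ℚ
toℚ k = + k / 1

Counts : ℕ → Set
Counts n = Fin n → Fin n → ℕ

total : (n : ℕ) → Counts n → ℕ
total n cnt = sumℕ n (λ x → sumℕ n (λ y → cnt x y))

_over_ : (k N : ℕ) → .{{NonZero N}} → ℚ
k over N = + k / N

p̂ : (n : ℕ) (cnt : Counts n) → .{{NonZero (total n cnt)}} → Fin n → ℚ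
p̂ n cnt x = sumℕ n (λ y → cnt x y) over total n cnt

q̂ : (n : ℕ) (cnt : Counts n) → .{{NonZero (total n cnt)}} → Fin n → ℚ
q̂ n cnt y = sumℕ n (λ x → cnt x y) over total n cnt

Δ̂ : (n : ℕ) (cnt : Counts n) → .{{NonZero (total n cnt)}} → Fin n → Fin n → ℚ
Δ̂ n cnt x y = (cnt x y over total n cnt) - p̂ n cnt x * q̂ n cnt y

normΔ̂² : (n : ℕ) (cnt : Counts n) → .{{NonZero (total n cnt)}} → ℚ
normΔ̂² n cnt = sumℚ n (λ x → sumℚ n (λ y → Δ̂ n cnt x y * Δ̂ n cnt x y))

ind : {A : ℕ} → Fin A → Fin A → ℕ → ℕ
ind i a k = if ⌊ i ≟ a ⌋ then k else 0

C : (n A : ℕ) → Counts n → (Fin n → Fin A) → (Fin n → Fin A) → Fin A → Fin A → ℕ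
C n A cnt h₁ h₂ a b =
  sumℕ n (λ x → ind (h₁ x) a (sumℕ n (λ y → ind (h₂ y) b (cnt x y))))

-- Δ̃ and its squared norm; N is the total stream length (= Σ_{a,b} C_{a,b})
Δ̃ : (n A : ℕ) (cnt : Counts n) → .{{NonZero (total n cnt)}} →
    (Fin n → Fin A) → (Fin n → Fin A) → Fin A → Fin A → ℚ
Δ̃ n A cnt h₁ h₂ a b =
  (c a b over N)
  - ((sumℕ A (λ b' → c a b') ℕ.* sumℕ A (λ a' → c a' b)) over (N ℕ.* N)) {{m*n≢0 N N}}
  where
    N = total n cnt
    c = C n A cnt h₁ h₂

normΔ̃² : (n A : ℕ) (cnt : Counts n) → .{{NonZero (total n cnt)}} →
         (Fin n → Fin A) → (Fin n → Fin A) → ℚ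
normΔ̃² n A cnt h₁ h₂ =
  sumℚ A (λ a → sumℚ A (λ b → Δ̃ n A cnt h₁ h₂ a b * Δ̃ n A cnt h₁ h₂ a b))

expectedNormΔ̃² : (n A : ℕ) (cnt : Counts n) → .{{NonZero (total n cnt)}} →
                 .{{NonZero A}} → ℚ
expectedNormΔ̃² n A cnt =
  ((1 over (A ℕ.^ n)) {{m^n≢0 A n}} * (1 over (A ℕ.^ n)) {{m^n≢0 A n}})
  * sumFun n A (λ h₁ → sumFun n A (λ h₂ → normΔ̃² n A cnt h₁ h₂))

module Submission where

-- Hashing is linear: Δ̃ a b = Σ_{x,y} [h₁ x = a] [h₂ y = b] Δ̂ x y, because the hashed counter
-- matrix has the hashed marginals. Expanding the square,
--   ‖Δ̃‖² = Σ [h₁ x = h₁ x′] [h₂ y = h₂ y′] Δ̂ x y Δ̂ x′ y′,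
-- and two coordinates of a uniform hash collide with probability δ x x′ (1 - 1/A) + 1/A. By
-- independence of h₁ and h₂ the expectation is the same sum with both indicators replaced by these
-- probabilities; the 1/A parts contribute nothing since every row and column of Δ̂ sums to zero,
-- leaving (1 - 1/A)² ‖Δ̂‖².

open import Defs
open import Algebra.Bundles using (CommutativeMonoid; Ring)
import Algebra.Properties.Semiring.Sum as SemiringSum
import Algebra.Properties.CommutativeSemigroup as CommSemigroupProperties
open import Data.Bool.Base using (if_then_else_; true; false)
open import Data.Fin.Base using (Fin; zero; suc)
open import Data.Fin.Properties using (_≟_)
import Data.Integer.Base as ℤ
import Data.Integer.Properties as ℤ
open import Data.Nat.Base as ℕ using (ℕ; zero; suc; NonZero; _≤_; _^_)
import Data.Nat.Properties as ℕₚ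
open import Data.Rational.Base using (ℚ; _+_; _*_; _-_; -_; 0ℚ; 1ℚ; fromℚᵘ)
open import Data.Rational.Properties
  using ( +-*-ring; +-0-group; *-1-commutativeMonoid; toℚᵘ-injective; toℚᵘ-fromℚᵘ
        ; toℚᵘ-homo-+; toℚᵘ-homo-*; fromℚᵘ-cong; +-identityˡ; +-identityʳ; +-inverseʳ
        ; *-assoc; *-comm; *-identityˡ; *-identityʳ; *-zeroˡ; *-zeroʳ
        ; *-distribˡ-+; *-distribʳ-+; neg-distrib-+; neg-distribʳ-*)
open import Data.Rational.Unnormalised.Base as ℚᵘ using (mkℚᵘ; *≡*)
import Data.Rational.Unnormalised.Properties as ℚᵘ
open import Data.Vec.Functional using (_∷_)
open import Function.Base using (_∘_)
open import Relation.Binary.PropositionalEquality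
open import Relation.Nullary.Decidable using (⌊_⌋; yes; no)
open import Relation.Nullary.Negation using (contradiction)

open import Algebra.Properties.Group +-0-group using (//-rightDividesˡ)
open CommSemigroupProperties (CommutativeMonoid.commutativeSemigroup *-1-commutativeMonoid)
  using (x∙yz≈y∙xz; xy∙z≈y∙xz)
open ≡-Reasoning

-- k over suc c unfolds to fromℚᵘ (mkℚᵘ (+ k) c), so identities between such quotients reduce to
-- cross-multiplication in ℚᵘ.
over-≃-+ : ∀ k c p q → mkℚᵘ (ℤ.+ k) c ℚᵘ.≃ p ℚᵘ.+ q → k over suc c ≡ fromℚᵘ p + fromℚᵘ q
over-≃-+ k c p q eq = toℚᵘ-injective (ℚᵘ.≃-trans (toℚᵘ-fromℚᵘ (mkℚᵘ (ℤ.+ k) c)) (ℚᵘ.≃-trans eq (ℚᵘ.≃-sym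
  (ℚᵘ.≃-trans (toℚᵘ-homo-+ (fromℚᵘ p) (fromℚᵘ q)) (ℚᵘ.+-cong (toℚᵘ-fromℚᵘ p) (toℚᵘ-fromℚᵘ q))))))

over-≃-* : ∀ k c p q → mkℚᵘ (ℤ.+ k) c ℚᵘ.≃ p ℚᵘ.* q → k over suc c ≡ fromℚᵘ p * fromℚᵘ q
over-≃-* k c p q eq = toℚᵘ-injective (ℚᵘ.≃-trans (toℚᵘ-fromℚᵘ (mkℚᵘ (ℤ.+ k) c)) (ℚᵘ.≃-trans eq (ℚᵘ.≃-sym
  (ℚᵘ.≃-trans (toℚᵘ-homo-* (fromℚᵘ p) (fromℚᵘ q)) (ℚᵘ.*-cong (toℚᵘ-fromℚᵘ p) (toℚᵘ-fromℚᵘ q))))))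

toℚ-homo-+ : ∀ k l → toℚ (k ℕ.+ l) ≡ toℚ k + toℚ l
toℚ-homo-+ k l = over-≃-+ (k ℕ.+ l) 0 (mkℚᵘ (ℤ.+ k) 0) (mkℚᵘ (ℤ.+ l) 0)
  (*≡* (cong (ℤ._* ℤ.+ 1) (trans (ℤ.pos-+ k l)
    (sym (cong₂ ℤ._+_ (ℤ.*-identityʳ (ℤ.+ k)) (ℤ.*-identityʳ (ℤ.+ l)))))))

over-homo-* : ∀ k l c d .{{_ : NonZero c}} .{{_ : NonZero d}} →
              ((k ℕ.* l) over (c ℕ.* d)) {{ℕₚ.m*n≢0 c d}} ≡ (k over c) * (l over d)
over-homo-* k l (suc c) (suc d) = over-≃-* (k ℕ.* l) _ (mkℚᵘ (ℤ.+ k) c) (mkℚᵘ (ℤ.+ l) d)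
  (*≡* (cong (ℤ._* ℤ.+ (suc c ℕ.* suc d)) (ℤ.pos-* k l)))

over≡toℚ*1/ : ∀ k N .{{_ : NonZero N}} → k over N ≡ toℚ k * (1 over N)
over≡toℚ*1/ k (suc d) = over-≃-* k d (mkℚᵘ (ℤ.+ k) 0) (mkℚᵘ (ℤ.+ 1) d)
  (*≡* (cong₂ ℤ._*_ (sym (ℤ.*-identityʳ (ℤ.+ k))) (cong ℤ.+_ (ℕₚ.*-identityˡ (suc d)))))

toℚ*1/≡1 : ∀ N .{{_ : NonZero N}} → toℚ N * (1 over N) ≡ 1ℚ
toℚ*1/≡1 N@(suc d) = trans (sym (over≡toℚ*1/ N N))
  (fromℚᵘ-cong {mkℚᵘ (ℤ.+ N) d} {mkℚᵘ (ℤ.+ 1) 0} (*≡* (ℤ.*-comm (ℤ.+ N) (ℤ.+ 1))))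

over-self : ∀ N .{{_ : NonZero N}} → N over N ≡ 1ℚ
over-self N = trans (over≡toℚ*1/ N N) (toℚ*1/≡1 N)

module ∑ = SemiringSum (Ring.semiring +-*-ring)

sumℚ≡sum : ∀ m (f : Fin m → ℚ) → sumℚ m f ≡ ∑.sum f
sumℚ≡sum zero    f = refl
sumℚ≡sum (suc m) f = cong (f zero +_) (sumℚ≡sum m (f ∘ suc))

sumℚ-cong : ∀ m {f g : Fin m → ℚ} → (∀ i → f i ≡ g i) → sumℚ m f ≡ sumℚ m g
sumℚ-cong zero    f≗g = refl
sumℚ-cong (suc m) f≗g = cong₂ _+_ (f≗g zero) (sumℚ-cong m (f≗g ∘ suc))

sumℚ-distrib-+ : ∀ m (f g : Fin m → ℚ) → sumℚ m (λ i → f i + g i) ≡ sumℚ m f + sumℚ m g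
sumℚ-distrib-+ m f g = trans (sumℚ≡sum m _)
  (trans (∑.∑-distrib-+ f g) (sym (cong₂ _+_ (sumℚ≡sum m f) (sumℚ≡sum m g))))

sumℚ-neg : ∀ m (f : Fin m → ℚ) → sumℚ m (λ i → - f i) ≡ - sumℚ m f
sumℚ-neg zero    f = refl
sumℚ-neg (suc m) f = trans (cong (- f zero +_) (sumℚ-neg m (f ∘ suc)))
  (sym (neg-distrib-+ (f zero) (sumℚ m (f ∘ suc))))

sumℚ-distrib-- : ∀ m (f g : Fin m → ℚ) → sumℚ m (λ i → f i - g i) ≡ sumℚ m f - sumℚ m g
sumℚ-distrib-- m f g = trans (sumℚ-distrib-+ m f (λ i → - g i)) (cong (sumℚ m f +_) (sumℚ-neg m g))

*-distribˡ-sumℚ : ∀ m c (f : Fin m → ℚ) → c * sumℚ m f ≡ sumℚ m (λ i → c * f i)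
*-distribˡ-sumℚ m c f = trans (cong (c *_) (sumℚ≡sum m f))
  (trans (∑.*-distribˡ-sum c f) (sym (sumℚ≡sum m _)))

*-distribʳ-sumℚ : ∀ m c (f : Fin m → ℚ) → sumℚ m f * c ≡ sumℚ m (λ i → f i * c)
*-distribʳ-sumℚ m c f = trans (cong (_* c) (sumℚ≡sum m f))
  (trans (∑.*-distribʳ-sum c f) (sym (sumℚ≡sum m _)))

sumℚ-comm : ∀ m k (f : Fin m → Fin k → ℚ) →
            sumℚ m (λ i → sumℚ k (f i)) ≡ sumℚ k (λ j → sumℚ m (λ i → f i j))
sumℚ-comm m k f = begin
  sumℚ m (λ i → sumℚ k (f i))              ≡⟨ sumℚ-cong m (λ i → sumℚ≡sum k (f i)) ⟩
  sumℚ m (λ i → ∑.sum (f i))               ≡⟨ sumℚ≡sum m _ ⟩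
  ∑.sum (λ i → ∑.sum (f i))                ≡⟨ ∑.∑-comm f ⟩
  ∑.sum (λ j → ∑.sum (λ i → f i j))        ≡⟨ sumℚ≡sum k _ ⟨
  sumℚ k (λ j → ∑.sum (λ i → f i j))       ≡⟨ sumℚ-cong k (λ j → sumℚ≡sum m (λ i → f i j)) ⟨
  sumℚ k (λ j → sumℚ m (λ i → f i j))      ∎

sumℚ-const : ∀ m c → sumℚ m (λ _ → c) ≡ toℚ m * c
sumℚ-const zero    c = sym (*-zeroˡ c)
sumℚ-const (suc m) c = begin
  c + sumℚ m (λ _ → c)       ≡⟨ cong₂ _+_ (sym (*-identityˡ c)) (sumℚ-const m c) ⟩
  1ℚ * c + toℚ m * c         ≡⟨ *-distribʳ-+ c 1ℚ (toℚ m) ⟨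
  (1ℚ + toℚ m) * c           ≡⟨ cong (_* c) (toℚ-homo-+ 1 m) ⟨
  toℚ (suc m) * c            ∎

toℚ-sumℕ : ∀ m (k : Fin m → ℕ) → toℚ (sumℕ m k) ≡ sumℚ m (toℚ ∘ k)
toℚ-sumℕ zero    k = refl
toℚ-sumℕ (suc m) k = trans (toℚ-homo-+ (k zero) _) (cong (toℚ (k zero) +_) (toℚ-sumℕ m (k ∘ suc)))

sumℚ-over : ∀ m (k : Fin m → ℕ) N .{{_ : NonZero N}} →
            sumℚ m (λ i → k i over N) ≡ sumℕ m k over N
sumℚ-over m k N = begin
  sumℚ m (λ i → k i over N)               ≡⟨ sumℚ-cong m (λ i → over≡toℚ*1/ (k i) N) ⟩
  sumℚ m (λ i → toℚ (k i) * (1 over N))   ≡⟨ *-distribʳ-sumℚ m (1 over N) (toℚ ∘ k) ⟨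
  sumℚ m (toℚ ∘ k) * (1 over N)           ≡⟨ cong (_* (1 over N)) (toℚ-sumℕ m k) ⟨
  toℚ (sumℕ m k) * (1 over N)             ≡⟨ over≡toℚ*1/ (sumℕ m k) N ⟨
  sumℕ m k over N                         ∎

δ : ∀ {m} → Fin m → Fin m → ℚ
δ i j = if ⌊ i ≟ j ⌋ then 1ℚ else 0ℚ

δ-≡ : ∀ {m} {i j : Fin m} → i ≡ j → δ i j ≡ 1ℚ
δ-≡ {i = i} {j} i≡j with i ≟ j
... | yes _   = refl
... | no i≢j = contradiction i≡j i≢j

δ-≢ : ∀ {m} {i j : Fin m} → i ≢ j → δ i j ≡ 0ℚ
δ-≢ {i = i} {j} i≢j with i ≟ j
... | yes i≡j = contradiction i≡j i≢j
... | no _    = refl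

δ-sym : ∀ {m} (i j : Fin m) → δ i j ≡ δ j i
δ-sym i j with i ≟ j
... | yes i≡j = sym (δ-≡ (sym i≡j))
... | no i≢j  = sym (δ-≢ (i≢j ∘ sym))

δ-suc : ∀ {m} (i j : Fin m) → δ (suc i) (suc j) ≡ δ i j
δ-suc i j with i ≟ j
... | yes _ = refl
... | no _  = refl

sumℚ-δ : ∀ m (i : Fin m) (g : Fin m → ℚ) → sumℚ m (λ j → δ i j * g j) ≡ g i
sumℚ-δ (suc m) zero g = begin
  1ℚ * g zero + sumℚ m (λ j → 0ℚ * g (suc j))
    ≡⟨ cong₂ _+_ (*-identityˡ (g zero)) (sym (*-distribˡ-sumℚ m 0ℚ (g ∘ suc))) ⟩
  g zero + 0ℚ * sumℚ m (g ∘ suc)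
    ≡⟨ trans (cong (g zero +_) (*-zeroˡ (sumℚ m (g ∘ suc)))) (+-identityʳ (g zero)) ⟩
  g zero ∎
sumℚ-δ (suc m) (suc i) g = begin
  0ℚ * g zero + sumℚ m (λ j → δ (suc i) (suc j) * g (suc j))
    ≡⟨ cong₂ _+_ (*-zeroˡ (g zero)) (sumℚ-cong m (λ j → cong (_* g (suc j)) (δ-suc i j))) ⟩
  0ℚ + sumℚ m (λ j → δ i j * g (suc j))
    ≡⟨ trans (+-identityˡ _) (sumℚ-δ m i (g ∘ suc)) ⟩
  g (suc i) ∎

toℚ-ind : ∀ {A} (i a : Fin A) k → toℚ (ind i a k) ≡ δ i a * toℚ k
toℚ-ind i a k with ⌊ i ≟ a ⌋
... | true  = sym (*-identityˡ (toℚ k))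
... | false = sym (*-zeroˡ (toℚ k))

Matrix : ℕ → Set
Matrix m = Fin m → Fin m → ℚ

⟪_,_⟫ : ∀ {m} → Matrix m → Matrix m → ℚ
⟪_,_⟫ {m} P F = sumℚ m (λ i → sumℚ m (λ j → P i j * F i j))

_⊗_ : ∀ {m} → (Fin m → ℚ) → (Fin m → ℚ) → Matrix m
(v ⊗ w) i j = v i * w j

⟪⟫-congʳ : ∀ {m} (P : Matrix m) {F G : Matrix m} → (∀ i j → F i j ≡ G i j) → ⟪ P , F ⟫ ≡ ⟪ P , G ⟫
⟪⟫-congʳ {m} P F≗G = sumℚ-cong m (λ i → sumℚ-cong m (λ j → cong (P i j *_) (F≗G i j)))

⟪⟫-*ʳ : ∀ {m} (P F : Matrix m) c → ⟪ P , (λ i j → c * F i j) ⟫ ≡ c * ⟪ P , F ⟫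
⟪⟫-*ʳ {m} P F c = trans
  (sumℚ-cong m (λ i → trans (sumℚ-cong m (λ j → x∙yz≈y∙xz (P i j) c (F i j)))
                            (sym (*-distribˡ-sumℚ m c _))))
  (sym (*-distribˡ-sumℚ m c _))

⟪⟫-sumʳ : ∀ {m} k (P : Matrix m) (F : Fin k → Matrix m) →
          ⟪ P , (λ i j → sumℚ k (λ b → F b i j)) ⟫ ≡ sumℚ k (λ b → ⟪ P , F b ⟫)
⟪⟫-sumʳ {m} k P F = trans
  (sumℚ-cong m (λ i → trans (sumℚ-cong m (λ j → *-distribˡ-sumℚ k (P i j) _)) (sumℚ-comm m k _)))
  (sumℚ-comm m k _)

⟪⟫-⊗ : ∀ {m} (P : Matrix m) (v w : Fin m → ℚ) →
       ⟪ P , v ⊗ w ⟫ ≡ sumℚ m (λ i → v i * sumℚ m (λ j → P i j * w j))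
⟪⟫-⊗ {m} P v w = sumℚ-cong m (λ i →
  trans (sumℚ-cong m (λ j → x∙yz≈y∙xz (P i j) (v i) (w j))) (sym (*-distribˡ-sumℚ m (v i) _)))

module _ {n A : ℕ} where

  push : (Fin n → Fin A) → (Fin n → ℚ) → Fin A → ℚ
  push h v a = sumℚ n (λ x → δ (h x) a * v x)

  collisions : (Fin n → Fin A) → Matrix n
  collisions h x x′ = δ (h x) (h x′)

  push-cong : ∀ h {v w : Fin n → ℚ} → (∀ x → v x ≡ w x) → ∀ a → push h v a ≡ push h w a
  push-cong h v≗w a = sumℚ-cong n (λ x → cong (δ (h x) a *_) (v≗w x))

  sumℚ-push : ∀ h (v : Fin n → ℚ) → sumℚ A (push h v) ≡ sumℚ n v
  sumℚ-push h v = trans (sumℚ-comm A n _) (sumℚ-cong n (λ x → sumℚ-δ A (h x) (λ _ → v x)))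

  push-sumℚ : ∀ h k (F : Fin k → Fin n → ℚ) a →
              push h (λ x → sumℚ k (λ b → F b x)) a ≡ sumℚ k (λ b → push h (F b) a)
  push-sumℚ h k F a = trans (sumℚ-cong n (λ x → *-distribˡ-sumℚ k (δ (h x) a) _)) (sumℚ-comm n k _)

  push-*ˡ : ∀ h c (v : Fin n → ℚ) a → push h (λ x → c * v x) a ≡ c * push h v a
  push-*ˡ h c v a = trans (sumℚ-cong n (λ x → x∙yz≈y∙xz (δ (h x) a) c (v x)))
    (sym (*-distribˡ-sumℚ n c _))

  push-*ʳ : ∀ h (v : Fin n → ℚ) c a → push h (λ x → v x * c) a ≡ push h v a * c
  push-*ʳ h v c a = trans (sumℚ-cong n (λ x → sym (*-assoc (δ (h x) a) (v x) c)))
    (sym (*-distribʳ-sumℚ n c _))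

  push-− : ∀ h (v w : Fin n → ℚ) a → push h (λ x → v x - w x) a ≡ push h v a - push h w a
  push-− h v w a = trans
    (sumℚ-cong n (λ x → trans (*-distribˡ-+ (δ (h x) a) (v x) (- w x))
                              (cong (δ (h x) a * v x +_) (sym (neg-distribʳ-* (δ (h x) a) (w x))))))
    (sumℚ-distrib-- n _ _)

  push-dot : ∀ h (v w : Fin n → ℚ) →
                sumℚ A (λ a → push h v a * push h w a) ≡ ⟪ collisions h , v ⊗ w ⟫
  push-dot h v w = begin
    sumℚ A (λ a → push h v a * push h w a)
      ≡⟨ sumℚ-cong A (λ a → *-distribʳ-sumℚ n (push h w a) _) ⟩
    sumℚ A (λ a → sumℚ n (λ x → (δ (h x) a * v x) * push h w a))
      ≡⟨ sumℚ-comm A n _ ⟩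
    sumℚ n (λ x → sumℚ A (λ a → (δ (h x) a * v x) * push h w a))
      ≡⟨ sumℚ-cong n (λ x → trans (sumℚ-cong A (λ a → xy∙z≈y∙xz (δ (h x) a) (v x) (push h w a)))
                                  (sym (*-distribˡ-sumℚ A (v x) _))) ⟩
    sumℚ n (λ x → v x * sumℚ A (λ a → δ (h x) a * push h w a))
      ≡⟨ sumℚ-cong n (λ x → cong (v x *_) (sumℚ-δ A (h x) (push h w))) ⟩
    sumℚ n (λ x → v x * sumℚ n (λ x′ → δ (h x′) (h x) * w x′))
      ≡⟨ sumℚ-cong n (λ x → cong (v x *_) (sumℚ-cong n (λ x′ → cong (_* w x′) (δ-sym (h x′) (h x))))) ⟩
    sumℚ n (λ x → v x * sumℚ n (λ x′ → collisions h x x′ * w x′))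
      ≡⟨ ⟪⟫-⊗ (collisions h) v w ⟨
    ⟪ collisions h , v ⊗ w ⟫ ∎

  push₂ : (Fin n → Fin A) → (Fin n → Fin A) → Matrix n → Fin A → Fin A → ℚ
  push₂ h₁ h₂ M a b = push h₁ (λ x → push h₂ (M x) b) a

  module _ (h₁ h₂ : Fin n → Fin A) where

    push₂-cong : ∀ {M M′ : Matrix n} → (∀ x y → M x y ≡ M′ x y) →
                 ∀ a b → push₂ h₁ h₂ M a b ≡ push₂ h₁ h₂ M′ a b
    push₂-cong M≗M′ a b = push-cong h₁ (λ x → push-cong h₂ (M≗M′ x) b) a

    push₂-− : ∀ (M M′ : Matrix n) a b →
              push₂ h₁ h₂ (λ x y → M x y - M′ x y) a b ≡ push₂ h₁ h₂ M a b - push₂ h₁ h₂ M′ a b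
    push₂-− M M′ a b = trans (push-cong h₁ (λ x → push-− h₂ (M x) (M′ x) b) a) (push-− h₁ _ _ a)

    push₂-*ʳ : ∀ (M : Matrix n) c a b → push₂ h₁ h₂ (λ x y → M x y * c) a b ≡ push₂ h₁ h₂ M a b * c
    push₂-*ʳ M c a b = trans (push-cong h₁ (λ x → push-*ʳ h₂ (M x) c b) a) (push-*ʳ h₁ _ c a)

    push₂-⊗ : ∀ (v w : Fin n → ℚ) a b → push₂ h₁ h₂ (v ⊗ w) a b ≡ push h₁ v a * push h₂ w b
    push₂-⊗ v w a b = trans (push-cong h₁ (λ x → push-*ˡ h₂ (v x) w b) a) (push-*ʳ h₁ v _ a)

    push₂-rowsum : ∀ (M : Matrix n) a → sumℚ A (push₂ h₁ h₂ M a) ≡ push h₁ (λ x → sumℚ n (M x)) a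
    push₂-rowsum M a = trans (sym (push-sumℚ h₁ A (λ b x → push h₂ (M x) b) a))
                            (push-cong h₁ (λ x → sumℚ-push h₂ (M x)) a)

    push₂-colsum : ∀ (M : Matrix n) b →
                   sumℚ A (λ a → push₂ h₁ h₂ M a b) ≡ push h₂ (λ y → sumℚ n (λ x → M x y)) b
    push₂-colsum M b = trans (sumℚ-push h₁ (λ x → push h₂ (M x) b)) (sym (push-sumℚ h₂ n M b))

    push₂-norm² : ∀ (M : Matrix n) →
                  sumℚ A (λ a → sumℚ A (λ b → push₂ h₁ h₂ M a b * push₂ h₁ h₂ M a b))
                  ≡ ⟪ collisions h₁ , (λ x x′ → ⟪ collisions h₂ , M x ⊗ M x′ ⟫) ⟫
    push₂-norm² M = begin
      sumℚ A (λ a → sumℚ A (λ b → push₂ h₁ h₂ M a b * push₂ h₁ h₂ M a b))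
        ≡⟨ sumℚ-comm A A _ ⟩
      sumℚ A (λ b → sumℚ A (λ a → push h₁ (u b) a * push h₁ (u b) a))
        ≡⟨ sumℚ-cong A (λ b → push-dot h₁ (u b) (u b)) ⟩
      sumℚ A (λ b → ⟪ collisions h₁ , u b ⊗ u b ⟫)
        ≡⟨ ⟪⟫-sumʳ A (collisions h₁) (λ b → u b ⊗ u b) ⟨
      ⟪ collisions h₁ , (λ x x′ → sumℚ A (λ b → push h₂ (M x) b * push h₂ (M x′) b)) ⟫
        ≡⟨ ⟪⟫-congʳ (collisions h₁) (λ x x′ → push-dot h₂ (M x) (M x′)) ⟩
      ⟪ collisions h₁ , (λ x x′ → ⟪ collisions h₂ , M x ⊗ M x′ ⟫) ⟫ ∎
      where
      u : Fin A → Fin n → ℚ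
      u b x = push h₂ (M x) b

sumFun-cong : ∀ n A {F G : (Fin n → Fin A) → ℚ} → (∀ h → F h ≡ G h) → sumFun n A F ≡ sumFun n A G
sumFun-cong zero    A F≗G = F≗G _
sumFun-cong (suc n) A F≗G = sumℚ-cong A (λ a → sumFun-cong n A (λ h → F≗G (a ∷ h)))

*-distribˡ-sumFun : ∀ n A c (F : (Fin n → Fin A) → ℚ) → c * sumFun n A F ≡ sumFun n A (λ h → c * F h)
*-distribˡ-sumFun zero    A c F = refl
*-distribˡ-sumFun (suc n) A c F = trans (*-distribˡ-sumℚ A c _)
  (sumℚ-cong A (λ a → *-distribˡ-sumFun n A c (λ h → F (a ∷ h))))

sumFun-sumℚ : ∀ n A m (F : Fin m → (Fin n → Fin A) → ℚ) →
              sumFun n A (λ h → sumℚ m (λ i → F i h)) ≡ sumℚ m (λ i → sumFun n A (F i))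
sumFun-sumℚ zero    A m F = refl
sumFun-sumℚ (suc n) A m F = trans (sumℚ-cong A (λ a → sumFun-sumℚ n A m (λ i h → F i (a ∷ h))))
  (sumℚ-comm A m _)

mean : (A : ℕ) .{{_ : NonZero A}} → (Fin A → ℚ) → ℚ
mean A f = (1 over A) * sumℚ A f

𝔼 : (n A : ℕ) .{{_ : NonZero A}} → ((Fin n → Fin A) → ℚ) → ℚ
𝔼 n A F = (1 over (A ^ n)) {{ℕₚ.m^n≢0 A n}} * sumFun n A F

module _ {A : ℕ} .{{_ : NonZero A}} where

  mean-const : ∀ c → mean A (λ _ → c) ≡ c
  mean-const c = begin
    (1 over A) * sumℚ A (λ _ → c)   ≡⟨ cong ((1 over A) *_) (sumℚ-const A c) ⟩
    (1 over A) * (toℚ A * c)        ≡⟨ *-assoc (1 over A) (toℚ A) c ⟨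
    ((1 over A) * toℚ A) * c        ≡⟨ cong (_* c) (trans (*-comm (1 over A) (toℚ A)) (toℚ*1/≡1 A)) ⟩
    1ℚ * c                          ≡⟨ *-identityˡ c ⟩
    c                               ∎

  mean-cong : ∀ {f g : Fin A → ℚ} → (∀ a → f a ≡ g a) → mean A f ≡ mean A g
  mean-cong f≗g = cong ((1 over A) *_) (sumℚ-cong A f≗g)

  mean-δ : ∀ a → mean A (δ a) ≡ 1 over A
  mean-δ a = trans (cong ((1 over A) *_) (trans (sumℚ-cong A (λ b → sym (*-identityʳ (δ a b))))
                                                 (sumℚ-δ A a (λ _ → 1ℚ))))
                   (*-identityʳ (1 over A))

  𝔼-cong : ∀ {n} {F G : (Fin n → Fin A) → ℚ} → (∀ h → F h ≡ G h) → 𝔼 n A F ≡ 𝔼 n A G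
  𝔼-cong {n} F≗G = cong ((1 over (A ^ n)) {{ℕₚ.m^n≢0 A n}} *_) (sumFun-cong n A F≗G)

  𝔼-*ˡ : ∀ {n} c (F : (Fin n → Fin A) → ℚ) → 𝔼 n A (λ h → c * F h) ≡ c * 𝔼 n A F
  𝔼-*ˡ {n} c F = begin
    w * sumFun n A (λ h → c * F h)  ≡⟨ cong (w *_) (*-distribˡ-sumFun n A c F) ⟨
    w * (c * sumFun n A F)          ≡⟨ x∙yz≈y∙xz w c _ ⟩
    c * (w * sumFun n A F)          ∎
    where w = (1 over (A ^ n)) {{ℕₚ.m^n≢0 A n}}

  𝔼-*ʳ : ∀ {n} (F : (Fin n → Fin A) → ℚ) c → 𝔼 n A (λ h → F h * c) ≡ 𝔼 n A F * c
  𝔼-*ʳ {n} F c = trans (𝔼-cong (λ h → *-comm (F h) c)) (trans (𝔼-*ˡ c F) (*-comm c _))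

  𝔼-sumℚ : ∀ {n} m (F : Fin m → (Fin n → Fin A) → ℚ) →
           𝔼 n A (λ h → sumℚ m (λ i → F i h)) ≡ sumℚ m (λ i → 𝔼 n A (F i))
  𝔼-sumℚ {n} m F = trans (cong (w *_) (sumFun-sumℚ n A m F)) (*-distribˡ-sumℚ m w _)
    where w = (1 over (A ^ n)) {{ℕₚ.m^n≢0 A n}}

  𝔼-suc : ∀ n (F : (Fin (suc n) → Fin A) → ℚ) → 𝔼 (suc n) A F ≡ mean A (λ a → 𝔼 n A (λ h → F (a ∷ h)))
  𝔼-suc n F = begin
    (1 over (A ℕ.* A ^ n)) {{ℕₚ.m^n≢0 A (suc n)}} * sumℚ A G
      ≡⟨ cong (_* sumℚ A G) (over-homo-* 1 1 A (A ^ n)) ⟩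
    ((1 over A) * w) * sumℚ A G
      ≡⟨ *-assoc (1 over A) w _ ⟩
    (1 over A) * (w * sumℚ A G)
      ≡⟨ cong ((1 over A) *_) (*-distribˡ-sumℚ A w G) ⟩
    mean A (λ a → 𝔼 n A (λ h → F (a ∷ h))) ∎
    where
    instance _ = ℕₚ.m^n≢0 A n
    w = 1 over (A ^ n)
    G : Fin A → ℚ
    G a = sumFun n A (λ h → F (a ∷ h))

  𝔼-const : ∀ n c → 𝔼 n A (λ _ → c) ≡ c
  𝔼-const zero    c = *-identityˡ c
  𝔼-const (suc n) c = trans (𝔼-suc n (λ _ → c)) (trans (mean-cong (λ _ → 𝔼-const n c)) (mean-const c))

  𝔼-coordinate : ∀ n (i : Fin n) (f : Fin A → ℚ) → 𝔼 n A (λ h → f (h i)) ≡ mean A f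
  𝔼-coordinate (suc n) zero    f = trans (𝔼-suc n (λ h → f (h zero)))
    (mean-cong (λ a → 𝔼-const n (f a)))
  𝔼-coordinate (suc n) (suc i) f = trans (𝔼-suc n (λ h → f (h (suc i))))
    (trans (mean-cong (λ _ → 𝔼-coordinate n i f)) (mean-const (mean A f)))

diagConst : ∀ {m} → ℚ → ℚ → Matrix m
diagConst α β i j = δ i j * α + β

module _ {A : ℕ} .{{_ : NonZero A}} where

  private
    α β : ℚ
    α = 1ℚ - (1 over A)
    β = 1 over A

  𝔼-δ-head : ∀ n (j : Fin n) → 𝔼 (suc n) A (λ h → δ (h zero) (h (suc j))) ≡ β
  𝔼-δ-head n j = begin
    𝔼 (suc n) A (λ h → δ (h zero) (h (suc j)))  ≡⟨ 𝔼-suc n (λ h → δ (h zero) (h (suc j))) ⟩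
    mean A (λ a → 𝔼 n A (λ h → δ a (h j)))
      ≡⟨ mean-cong (λ a → trans (𝔼-coordinate n j (δ a)) (mean-δ a)) ⟩
    mean A (λ _ → β)                            ≡⟨ mean-const β ⟩
    β                                           ∎

  𝔼-collision : ∀ n (i j : Fin n) → 𝔼 n A (λ h → δ (h i) (h j)) ≡ diagConst α β i j
  𝔼-collision (suc n) zero zero = begin
    𝔼 (suc n) A (λ h → δ (h zero) (h zero))  ≡⟨ 𝔼-suc n (λ h → δ (h zero) (h zero)) ⟩
    mean A (λ a → 𝔼 n A (λ _ → δ a a))       ≡⟨ mean-cong (λ a → trans (𝔼-const n (δ a a)) (δ-≡ refl)) ⟩
    mean A (λ _ → 1ℚ)                        ≡⟨ mean-const 1ℚ ⟩
    1ℚ                                       ≡⟨ //-rightDividesˡ β 1ℚ ⟨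
    α + β                                    ≡⟨ cong (_+ β) (*-identityˡ α) ⟨
    1ℚ * α + β                               ∎
  𝔼-collision (suc n) zero (suc j) =
    trans (𝔼-δ-head n j) (sym (trans (cong (_+ β) (*-zeroˡ α)) (+-identityˡ β)))
  𝔼-collision (suc n) (suc i) zero =
    trans (𝔼-cong (λ h → δ-sym (h (suc i)) (h zero))) (𝔼-collision (suc n) zero (suc i))
  𝔼-collision (suc n) (suc i) (suc j) = begin
    𝔼 (suc n) A (λ h → δ (h (suc i)) (h (suc j)))  ≡⟨ 𝔼-suc n (λ h → δ (h (suc i)) (h (suc j))) ⟩
    mean A (λ _ → 𝔼 n A (λ h → δ (h i) (h j)))     ≡⟨ mean-cong (λ _ → 𝔼-collision n i j) ⟩
    mean A (λ _ → diagConst α β i j)               ≡⟨ mean-const (diagConst α β i j) ⟩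
    diagConst α β i j                              ≡⟨ cong (λ d → d * α + β) (δ-suc i j) ⟨
    diagConst α β (suc i) (suc j)                  ∎

  𝔼-⟪collisions⟫ : ∀ {n} (F : Matrix n) →
                   𝔼 n A (λ h → ⟪ collisions h , F ⟫) ≡ ⟪ diagConst α β , F ⟫
  𝔼-⟪collisions⟫ {n} F =
    trans (𝔼-sumℚ n (λ x h → sumℚ n (λ x′ → δ (h x) (h x′) * F x x′))) (sumℚ-cong n (λ x →
    trans (𝔼-sumℚ n (λ x′ h → δ (h x) (h x′) * F x x′)) (sumℚ-cong n (λ x′ →
    trans (𝔼-*ʳ (λ h → δ (h x) (h x′)) (F x x′)) (cong (_* F x x′) (𝔼-collision n x x′))))))

  𝔼-⟪⟫ʳ : ∀ {n} (P : Matrix n) (F : (Fin n → Fin A) → Matrix n) →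
          𝔼 n A (λ h → ⟪ P , F h ⟫) ≡ ⟪ P , (λ i j → 𝔼 n A (λ h → F h i j)) ⟫
  𝔼-⟪⟫ʳ {n} P F =
    trans (𝔼-sumℚ n (λ i h → sumℚ n (λ j → P i j * F h i j))) (sumℚ-cong n (λ i →
    trans (𝔼-sumℚ n (λ j h → P i j * F h i j)) (sumℚ-cong n (λ j →
    𝔼-*ˡ (P i j) (λ h → F h i j)))))

  𝔼-independent : ∀ n (G : (Fin n → Fin A) → (Fin n → Fin A) → ℚ) →
       ((1 over (A ^ n)) {{ℕₚ.m^n≢0 A n}} * (1 over (A ^ n)) {{ℕₚ.m^n≢0 A n}})
         * sumFun n A (λ h₁ → sumFun n A (G h₁))
       ≡ 𝔼 n A (λ h₁ → 𝔼 n A (G h₁))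
  𝔼-independent n G = trans (*-assoc w w _) (cong (w *_) (*-distribˡ-sumFun n A w _))
    where w = (1 over (A ^ n)) {{ℕₚ.m^n≢0 A n}}

dependence-rowsum : ∀ {m} (P : Matrix m) (p q : Fin m → ℚ) → (∀ i → sumℚ m (P i) ≡ p i) →
                    sumℚ m q ≡ 1ℚ → ∀ i → sumℚ m (λ j → P i j - p i * q j) ≡ 0ℚ
dependence-rowsum {m} P p q P-row Σq≡1 i = begin
  sumℚ m (λ j → P i j - p i * q j)        ≡⟨ sumℚ-distrib-- m (P i) (λ j → p i * q j) ⟩
  sumℚ m (P i) - sumℚ m (λ j → p i * q j) ≡⟨ cong₂ _-_ (P-row i) (sym (*-distribˡ-sumℚ m (p i) q)) ⟩
  p i - p i * sumℚ m q                    ≡⟨ cong (λ t → p i - p i * t) Σq≡1 ⟩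
  p i - p i * 1ℚ                          ≡⟨ cong (λ t → p i - t) (*-identityʳ (p i)) ⟩
  p i - p i                               ≡⟨ +-inverseʳ (p i) ⟩
  0ℚ                                      ∎

dependence-colsum : ∀ {m} (P : Matrix m) (p q : Fin m → ℚ) → (∀ j → sumℚ m (λ i → P i j) ≡ q j) →
                    sumℚ m p ≡ 1ℚ → ∀ j → sumℚ m (λ i → P i j - p i * q j) ≡ 0ℚ
dependence-colsum {m} P p q P-col Σp≡1 j = begin
  sumℚ m (λ i → P i j - p i * q j)          ≡⟨ sumℚ-distrib-- m (λ i → P i j) (λ i → p i * q j) ⟩
  sumℚ m (λ i → P i j) - sumℚ m (λ i → p i * q j)
                                            ≡⟨ cong₂ _-_ (P-col j) (sym (*-distribʳ-sumℚ m (q j) p)) ⟩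
  q j - sumℚ m p * q j                      ≡⟨ cong (λ t → q j - t * q j) Σp≡1 ⟩
  q j - 1ℚ * q j                            ≡⟨ cong (λ t → q j - t) (*-identityˡ (q j)) ⟩
  q j - q j                                 ≡⟨ +-inverseʳ (q j) ⟩
  0ℚ                                        ∎

toℚ-C : ∀ {n A} (cnt : Counts n) (h₁ h₂ : Fin n → Fin A) a b →
        toℚ (C n A cnt h₁ h₂ a b) ≡ push₂ h₁ h₂ (λ x y → toℚ (cnt x y)) a b
toℚ-C {n} cnt h₁ h₂ a b = trans (toℚ-sumℕ n _) (sumℚ-cong n (λ x →
  trans (toℚ-ind (h₁ x) a _) (cong (δ (h₁ x) a *_) (trans (toℚ-sumℕ n _) (sumℚ-cong n (λ y →
    toℚ-ind (h₂ y) b (cnt x y)))))))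

module _ {n : ℕ} (cnt : Counts n) .{{_ : NonZero (total n cnt)}} where

  private
    N = total n cnt

    P̂ : Matrix n
    P̂ x y = cnt x y over N

  sum-p̂ : sumℚ n (p̂ n cnt) ≡ 1ℚ
  sum-p̂ = trans (sumℚ-over n (λ x → sumℕ n (cnt x)) N) (over-self N)

  sum-q̂ : sumℚ n (q̂ n cnt) ≡ 1ℚ
  sum-q̂ = begin
    sumℚ n (q̂ n cnt)                        ≡⟨ sumℚ-cong n (λ y → sumℚ-over n (λ x → cnt x y) N) ⟨
    sumℚ n (λ y → sumℚ n (λ x → P̂ x y))     ≡⟨ sumℚ-comm n n (λ y x → P̂ x y) ⟩
    sumℚ n (λ x → sumℚ n (P̂ x))             ≡⟨ sumℚ-cong n (λ x → sumℚ-over n (cnt x) N) ⟩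
    sumℚ n (p̂ n cnt)                        ≡⟨ sum-p̂ ⟩
    1ℚ                                      ∎

  Δ̂-rowsum : ∀ x → sumℚ n (Δ̂ n cnt x) ≡ 0ℚ
  Δ̂-rowsum = dependence-rowsum P̂ (p̂ n cnt) (q̂ n cnt) (λ x → sumℚ-over n (cnt x) N) sum-q̂

  Δ̂-colsum : ∀ y → sumℚ n (λ x → Δ̂ n cnt x y) ≡ 0ℚ
  Δ̂-colsum = dependence-colsum P̂ (p̂ n cnt) (q̂ n cnt) (λ y → sumℚ-over n (λ x → cnt x y) N) sum-p̂

  module _ {A : ℕ} (h₁ h₂ : Fin n → Fin A) where

    private
      c : Fin A → Fin A → ℕ
      c = C n A cnt h₁ h₂

    C-over : ∀ a b → c a b over N ≡ push₂ h₁ h₂ P̂ a b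
    C-over a b = begin
      c a b over N                                          ≡⟨ over≡toℚ*1/ (c a b) N ⟩
      toℚ (c a b) * (1 over N)
        ≡⟨ cong (_* (1 over N)) (toℚ-C cnt h₁ h₂ a b) ⟩
      push₂ h₁ h₂ (λ x y → toℚ (cnt x y)) a b * (1 over N)  ≡⟨ push₂-*ʳ h₁ h₂ _ (1 over N) a b ⟨
      push₂ h₁ h₂ (λ x y → toℚ (cnt x y) * (1 over N)) a b
        ≡⟨ push₂-cong h₁ h₂ (λ x y → over≡toℚ*1/ (cnt x y) N) a b ⟨
      push₂ h₁ h₂ P̂ a b                                     ∎

    rowsumC-over : ∀ a → sumℕ A (c a) over N ≡ push h₁ (p̂ n cnt) a
    rowsumC-over a = begin
      sumℕ A (c a) over N               ≡⟨ sumℚ-over A (c a) N ⟨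
      sumℚ A (λ b → c a b over N)       ≡⟨ sumℚ-cong A (C-over a) ⟩
      sumℚ A (push₂ h₁ h₂ P̂ a)          ≡⟨ push₂-rowsum h₁ h₂ P̂ a ⟩
      push h₁ (λ x → sumℚ n (P̂ x)) a    ≡⟨ push-cong h₁ (λ x → sumℚ-over n (cnt x) N) a ⟩
      push h₁ (p̂ n cnt) a               ∎

    colsumC-over : ∀ b → sumℕ A (λ a → c a b) over N ≡ push h₂ (q̂ n cnt) b
    colsumC-over b = begin
      sumℕ A (λ a → c a b) over N              ≡⟨ sumℚ-over A (λ a → c a b) N ⟨
      sumℚ A (λ a → c a b over N)              ≡⟨ sumℚ-cong A (λ a → C-over a b) ⟩
      sumℚ A (λ a → push₂ h₁ h₂ P̂ a b)         ≡⟨ push₂-colsum h₁ h₂ P̂ b ⟩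
      push h₂ (λ y → sumℚ n (λ x → P̂ x y)) b
        ≡⟨ push-cong h₂ (λ y → sumℚ-over n (λ x → cnt x y) N) b ⟩
      push h₂ (q̂ n cnt) b                      ∎

    Δ̃≡push₂Δ̂ : ∀ a b → Δ̃ n A cnt h₁ h₂ a b ≡ push₂ h₁ h₂ (Δ̂ n cnt) a b
    Δ̃≡push₂Δ̂ a b = begin
      Δ̃ n A cnt h₁ h₂ a b
        ≡⟨ cong₂ _-_ (C-over a b) (over-homo-* row col N N) ⟩
      push₂ h₁ h₂ P̂ a b - (row over N) * (col over N)
        ≡⟨ cong (λ t → push₂ h₁ h₂ P̂ a b - t) (cong₂ _*_ (rowsumC-over a) (colsumC-over b)) ⟩
      push₂ h₁ h₂ P̂ a b - push h₁ (p̂ n cnt) a * push h₂ (q̂ n cnt) b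
        ≡⟨ cong (λ t → push₂ h₁ h₂ P̂ a b - t) (push₂-⊗ h₁ h₂ (p̂ n cnt) (q̂ n cnt) a b) ⟨
      push₂ h₁ h₂ P̂ a b - push₂ h₁ h₂ (p̂ n cnt ⊗ q̂ n cnt) a b
        ≡⟨ push₂-− h₁ h₂ P̂ (p̂ n cnt ⊗ q̂ n cnt) a b ⟨
      push₂ h₁ h₂ (Δ̂ n cnt) a b ∎
      where
      row col : ℕ
      row = sumℕ A (c a)
      col = sumℕ A (λ a′ → c a′ b)

    normΔ̃²≡⟪collisions⟫ : normΔ̃² n A cnt h₁ h₂
                          ≡ ⟪ collisions h₁ , (λ x x′ → ⟪ collisions h₂ , Δ̂ n cnt x ⊗ Δ̂ n cnt x′ ⟫) ⟫
    normΔ̃²≡⟪collisions⟫ = trans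
      (sumℚ-cong A (λ a → sumℚ-cong A (λ b → cong₂ _*_ (Δ̃≡push₂Δ̂ a b) (Δ̃≡push₂Δ̂ a b))))
      (push₂-norm² h₁ h₂ (Δ̂ n cnt))

module _ {m : ℕ} (α β : ℚ) where

  diagConst-apply : ∀ (w : Fin m → ℚ) → sumℚ m w ≡ 0ℚ → ∀ i →
                    sumℚ m (λ j → diagConst α β i j * w j) ≡ α * w i
  diagConst-apply w Σw≡0 i = begin
    sumℚ m (λ j → (δ i j * α + β) * w j)
      ≡⟨ sumℚ-cong m (λ j → trans (*-distribʳ-+ (w j) (δ i j * α) β)
                                  (cong (_+ β * w j) (*-assoc (δ i j) α (w j)))) ⟩
    sumℚ m (λ j → δ i j * (α * w j) + β * w j)
      ≡⟨ sumℚ-distrib-+ m _ _ ⟩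
    sumℚ m (λ j → δ i j * (α * w j)) + sumℚ m (λ j → β * w j)
      ≡⟨ cong₂ _+_ (sumℚ-δ m i (λ j → α * w j)) (sym (*-distribˡ-sumℚ m β w)) ⟩
    α * w i + β * sumℚ m w
      ≡⟨ cong (λ t → α * w i + β * t) Σw≡0 ⟩
    α * w i + β * 0ℚ
      ≡⟨ trans (cong (α * w i +_) (*-zeroʳ β)) (+-identityʳ (α * w i)) ⟩
    α * w i ∎

  ⟪diagConst⟫-⊗ : ∀ (v w : Fin m → ℚ) → sumℚ m w ≡ 0ℚ →
                  ⟪ diagConst α β , v ⊗ w ⟫ ≡ α * sumℚ m (λ i → v i * w i)
  ⟪diagConst⟫-⊗ v w Σw≡0 = begin
    ⟪ diagConst α β , v ⊗ w ⟫
      ≡⟨ ⟪⟫-⊗ (diagConst α β) v w ⟩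
    sumℚ m (λ i → v i * sumℚ m (λ j → diagConst α β i j * w j))
      ≡⟨ sumℚ-cong m (λ i → cong (v i *_) (diagConst-apply w Σw≡0 i)) ⟩
    sumℚ m (λ i → v i * (α * w i))
      ≡⟨ sumℚ-cong m (λ i → x∙yz≈y∙xz (v i) α (w i)) ⟩
    sumℚ m (λ i → α * (v i * w i))
      ≡⟨ *-distribˡ-sumℚ m α _ ⟨
    α * sumℚ m (λ i → v i * w i) ∎

  ⟪diagConst⟫²-centred : ∀ (M : Matrix m) →
                          (∀ i → sumℚ m (M i) ≡ 0ℚ) → (∀ j → sumℚ m (λ i → M i j) ≡ 0ℚ) →
                          ⟪ diagConst α β , (λ i i′ → ⟪ diagConst α β , M i ⊗ M i′ ⟫) ⟫
                          ≡ (α * α) * sumℚ m (λ i → sumℚ m (λ j → M i j * M i j))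
  ⟪diagConst⟫²-centred M rows cols = begin
    ⟪ K , (λ i i′ → ⟪ K , M i ⊗ M i′ ⟫) ⟫
      ≡⟨ ⟪⟫-congʳ K (λ i i′ → ⟪diagConst⟫-⊗ (M i) (M i′) (rows i′)) ⟩
    ⟪ K , (λ i i′ → α * sumℚ m (λ j → M i j * M i′ j)) ⟫
      ≡⟨ ⟪⟫-*ʳ K (λ i i′ → sumℚ m (λ j → M i j * M i′ j)) α ⟩
    α * ⟪ K , (λ i i′ → sumℚ m (λ j → M i j * M i′ j)) ⟫
      ≡⟨ cong (α *_) (⟪⟫-sumʳ m K (λ j → column j ⊗ column j)) ⟩
    α * sumℚ m (λ j → ⟪ K , column j ⊗ column j ⟫)
      ≡⟨ cong (α *_) (sumℚ-cong m (λ j → ⟪diagConst⟫-⊗ (column j) (column j) (cols j))) ⟩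
    α * sumℚ m (λ j → α * sumℚ m (λ i → M i j * M i j))
      ≡⟨ cong (α *_) (*-distribˡ-sumℚ m α _) ⟨
    α * (α * sumℚ m (λ j → sumℚ m (λ i → M i j * M i j)))
      ≡⟨ *-assoc α α _ ⟨
    (α * α) * sumℚ m (λ j → sumℚ m (λ i → M i j * M i j))
      ≡⟨ cong ((α * α) *_) (sumℚ-comm m m (λ j i → M i j * M i j)) ⟩
    (α * α) * sumℚ m (λ i → sumℚ m (λ j → M i j * M i j)) ∎
    where
    K = diagConst α β
    column : Fin m → Fin m → ℚ
    column j i = M i j

lemma5 : (n A : ℕ) → 1 ≤ n → 2 ≤ A → .{{_ : NonZero A}} →
    (cnt : Counts n) → .{{_ : NonZero (total n cnt)}} →
    expectedNormΔ̃² n A cnt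
    ≡ ((1ℚ - (1 over A)) * (1ℚ - (1 over A))) * normΔ̂² n cnt
lemma5 n A _ _ cnt = begin
    expectedNormΔ̃² n A cnt
  ≡⟨ 𝔼-independent {A = A} n (normΔ̃² n A cnt) ⟩
    𝔼 n A (λ h₁ → 𝔼 n A (λ h₂ → normΔ̃² n A cnt h₁ h₂))
  ≡⟨ 𝔼-cong (λ h₁ → 𝔼-cong (λ h₂ → normΔ̃²≡⟪collisions⟫ cnt h₁ h₂)) ⟩
    𝔼 n A (λ h₁ → 𝔼 n A (λ h₂ → ⟪ collisions h₁ , (λ x x′ → ⟪ collisions h₂ , D x ⊗ D x′ ⟫) ⟫))
  ≡⟨ 𝔼-cong (λ h₁ → 𝔼-⟪⟫ʳ (collisions h₁) (λ h₂ x x′ → ⟪ collisions h₂ , D x ⊗ D x′ ⟫)) ⟩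
    𝔼 n A (λ h₁ → ⟪ collisions h₁ , (λ x x′ → 𝔼 n A (λ h₂ → ⟪ collisions h₂ , D x ⊗ D x′ ⟫)) ⟫)
  ≡⟨ 𝔼-⟪collisions⟫ {A = A} (λ x x′ → 𝔼 n A (λ h₂ → ⟪ collisions h₂ , D x ⊗ D x′ ⟫)) ⟩
    ⟪ K , (λ x x′ → 𝔼 n A (λ h₂ → ⟪ collisions h₂ , D x ⊗ D x′ ⟫)) ⟫
  ≡⟨ ⟪⟫-congʳ K (λ x x′ → 𝔼-⟪collisions⟫ {A = A} (D x ⊗ D x′)) ⟩
    ⟪ K , (λ x x′ → ⟪ K , D x ⊗ D x′ ⟫) ⟫
  ≡⟨ ⟪diagConst⟫²-centred (1ℚ - (1 over A)) (1 over A) D (Δ̂-rowsum cnt) (Δ̂-colsum cnt) ⟩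
    ((1ℚ - (1 over A)) * (1ℚ - (1 over A))) * normΔ̂² n cnt
  ∎
  where
  D = Δ̂ n cnt
  K = diagConst (1ℚ - (1 over A)) (1 over A)
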